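{- Let $G$ be a finite connected graph. If $\mathrm{mp}(G)\geq 4$, then $\gamma_b(G)\leq 3\,\mathrm{mp}(G)-4$.
   Context: For a graph $G=(V,E)$ with distance $d(u,v)$, the ball of radius $r$ around $v$ is $N_r(v)=\{u\in V : d(u,v)\leq r\}$. A dominating broadcast of $G$ is a function $f: V\to \mathbb{N}$ such that for every $u\in V$ there is $v\in V$ with $f(v)>0$ and $d(u,v)\leq f(v)$; its cost is $\sum_{v\in V} f(v)$. The broadcast number $\gamma_b(G)$ is the minimum cost of a dominating broadcast of $G$. A multipacking of $G$ is a set $P\subseteq V$ such that for every vertex $v$ and every positive integer $r$, $|N_r(v)\cap P|\leq r$. The multipacking number $\mathrm{mp}(G)$ is the maximum size of a multipacking of $G$. -}

module Defs where

open import Data.Nat using (ℕ; zero; suc; _≤_; _<_)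
open import Data.Bool using (Bool; true; false; _∧_; _∨_)
open import Data.Fin using (Fin)
open import Data.Fin.Properties using (_≟_)
open import Data.Fin.Subset using (Subset; _∩_; ∣_∣)
open import Data.Vec using (tabulate)
open import Data.Vec.Functional using () renaming (foldr to vfoldr)
open import Data.Product using (Σ; ∃; _×_)
open import Relation.Binary.PropositionalEquality using (_≡_)
open import Relation.Nullary.Decidable using (⌊_⌋)

record Graph (n : ℕ) : Set where
  field
    adj       : Fin n → Fin n → Bool
    adj-sym   : ∀ u v → adj u v ≡ adj v u
    adj-irref : ∀ v → adj v v ≡ false

open Graph public

anyV : ∀ {n} → (Fin n → Bool) → Bool
anyV {n} p = vfoldr (λ b acc → b ∨ acc) false p

-- within G r u v  is  true  iff  d(u,v) ≤ r  (there is a walk of length ≤ r)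
within : ∀ {n} → Graph n → ℕ → Fin n → Fin n → Bool
within G zero    u v = ⌊ u ≟ v ⌋
within G (suc r) u v = within G r u v ∨ anyV (λ w → adj G u w ∧ within G r w v)

Connected : ∀ {n} → Graph n → Set
Connected {n} G = ∀ (u v : Fin n) → ∃ λ r → within G r u v ≡ true

ball : ∀ {n} → Graph n → ℕ → Fin n → Subset n
ball G r v = tabulate (λ u → within G r u v)

IsMultipacking : ∀ {n} → Graph n → Subset n → Set
IsMultipacking {n} G P = ∀ (v : Fin n) (r : ℕ) → 1 ≤ r → ∣ ball G r v ∩ P ∣ ≤ r

IsMultipackingNumber : ∀ {n} → Graph n → ℕ → Set
IsMultipackingNumber {n} G m =
  (Σ (Subset n) λ P → IsMultipacking G P × ∣ P ∣ ≡ m)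
  × (∀ (P : Subset n) → IsMultipacking G P → ∣ P ∣ ≤ m)

IsDominatingBroadcast : ∀ {n} → Graph n → (Fin n → ℕ) → Set
IsDominatingBroadcast {n} G f =
  ∀ (u : Fin n) → ∃ λ (v : Fin n) → (0 < f v) × (within G (f v) u v ≡ true)

cost : ∀ {n} → (Fin n → ℕ) → ℕ
cost f = vfoldr Data.Nat._+_ 0 f

-- Write m = M + 1 and K = 3m − 4, so that K + 1 = 3M.  If some vertex c has eccentricity
-- at most K, broadcasting K from c dominates G.  Otherwise every vertex has eccentricity at
-- least 3M: take a geodesic p(0), …, p(3M) and a vertex w at distance at least 3M from p(4).
-- Then {w} ∪ {p(0), p(3), …, p(3M)} is a multipacking with M + 2 = m + 1 elements,
-- contradicting mp(G) = m.  Two points p(3i), p(3j) of a ball of radius r satisfy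
-- 3|i − j| ≤ 2r, which bounds the count for balls avoiding w and for r ≥ 4.  For r ≤ 3 one
-- uses d(w, p(3i)) ≥ 3M − |3i − 4|: w is at distance at least 4 from every p(3i), and at
-- least 7 unless i ∈ {0, M}.
module Submission where

open import Data.Bool using (Bool; true; false; _∧_; _∨_; if_then_else_)
open import Data.Bool.Properties using (∧-zeroʳ; ∨-zeroʳ; ¬-not) renaming (_≟_ to _≟ᵇ_)
open import Data.Fin using (Fin; zero; suc)
open import Data.Fin.Properties using (_≟_; any?; all?; ¬∀⟶∃¬)
open import Data.Fin.Subset using (Subset; _∩_; ∣_∣)
open import Data.Nat using (ℕ; zero; suc; _+_; _*_; _∸_; _≤_; _<_; _≰_; z≤n; s≤s; z<s; ∣_-_∣)
open import Data.Nat.Properties hiding (_≟_)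
open import Data.Nat.Tactic.RingSolver using (solve-∀)
open import Data.Product using (Σ; ∃; _×_; _,_; proj₁; proj₂)
open import Data.Sum using (_⊎_; inj₁; inj₂)
open import Data.Vec using (tabulate; _∷_)
open import Function using (_∘_)
open import Relation.Binary.PropositionalEquality
open import Relation.Nullary using (¬_; does; yes; no; contradiction)

open import Defs

open import Algebra.Properties.CommutativeMonoid.Sum +-0-commutativeMonoid
  using (sum; sum-cong-≗; ∑-distrib-+; sum-replicate-zero)

3d≤k<3[1+s]⇒d≤s : ∀ {d k s} → 3 * d ≤ k → k < 3 * suc s → d ≤ s
3d≤k<3[1+s]⇒d≤s 3d≤k k<3[1+s] = ≤-pred (*-cancelˡ-< 3 _ _ (≤-<-trans 3d≤k k<3[1+s]))

2[1+s]<3[1+s] : ∀ s → suc s + suc s < 3 * suc s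
2[1+s]<3[1+s] s = +-monoʳ-< (suc s) (m<m+n (suc s) z<s)

2[4+t]<3[3+t] : ∀ t → (4 + t) + (4 + t) < 3 * (3 + t)
2[4+t]<3[3+t] t = subst ((4 + t) + (4 + t) <_) (≡-3[3+t] t) (+-monoʳ-< (4 + t) (m<m+n (4 + t) z<s))
  where
  ≡-3[3+t] : ∀ t → (4 + t) + ((4 + t) + suc t) ≡ 3 * (3 + t)
  ≡-3[3+t] = solve-∀

∣m-n∣≤o : ∀ {m n o} → n ≤ m + o → m ≤ n + o → ∣ m - n ∣ ≤ o
∣m-n∣≤o {m} {n} n≤m+o m≤n+o with ≤-total m n
... | inj₁ m≤n rewrite m≤n⇒∣m-n∣≡n∸m m≤n = m≤n+o⇒m∸n≤o n m n≤m+o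
... | inj₂ n≤m rewrite m≤n⇒∣n-m∣≡n∸m n≤m = m≤n+o⇒m∸n≤o m n m≤n+o

3[2+j]≡4+[2+3j] : ∀ j → 3 * (2 + j) ≡ 4 + (2 + 3 * j)
3[2+j]≡4+[2+3j] = solve-∀

∣3[2+j]-4∣≡2+3j : ∀ j → ∣ 3 * (2 + j) - 4 ∣ ≡ 2 + 3 * j
∣3[2+j]-4∣≡2+3j j =
  trans (cong (λ x → ∣ x - 4 ∣) (3[2+j]≡4+[2+3j] j)) (∣m+n-m+o∣≡∣n-o∣ 4 (2 + 3 * j) 0)

4+∣3i-4∣≤3M : ∀ {i M} → 3 ≤ M → i ≤ M → 4 + ∣ 3 * i - 4 ∣ ≤ 3 * M
4+∣3i-4∣≤3M {zero}                3≤M _   = ≤-trans (n≤1+n 8) (*-monoʳ-≤ 3 3≤M)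
4+∣3i-4∣≤3M {suc zero}            3≤M _   = ≤-trans (m≤m+n 5 4) (*-monoʳ-≤ 3 3≤M)
4+∣3i-4∣≤3M {suc (suc j)} {M} _   i≤M rewrite ∣3[2+j]-4∣≡2+3j j =
  subst (_≤ 3 * M) (3[2+j]≡4+[2+3j] j) (*-monoʳ-≤ 3 i≤M)

7+∣3i-4∣≤3M : ∀ {i M} → 3 ≤ M → 0 < i → i < M → 7 + ∣ 3 * i - 4 ∣ ≤ 3 * M
7+∣3i-4∣≤3M {suc zero}            3≤M _ _   = ≤-trans (n≤1+n 8) (*-monoʳ-≤ 3 3≤M)
7+∣3i-4∣≤3M {suc (suc j)} {M} _   _ i<M rewrite ∣3[2+j]-4∣≡2+3j j =
  subst (_≤ 3 * M) (≡-7+[2+3j] j) (*-monoʳ-≤ 3 i<M)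
  where
  ≡-7+[2+3j] : ∀ j → 3 * (3 + j) ≡ 7 + (2 + 3 * j)
  ≡-7+[2+3j] = solve-∀

1+[3[1+M]∸4]≡3M : ∀ M → 1 ≤ M → suc (3 * suc M ∸ 4) ≡ 3 * M
1+[3[1+M]∸4]≡3M (suc M) _ = trans (cong (λ x → suc (x ∸ 4)) (*-suc 3 (suc M))) (suc-pred (3 * suc M))

indicator : Bool → ℕ
indicator true  = 1
indicator false = 0

count : (ℕ → Bool) → ℕ → ℕ
count h zero    = 0
count h (suc k) = indicator (h 0) + count (h ∘ suc) k

count-const-true : ∀ k → count (λ _ → true) k ≡ k
count-const-true zero    = refl
count-const-true (suc k) = cong suc (count-const-true k)

count-≤-bound : ∀ h k t → (∀ {i} → i < k → h i ≡ true → i < t) → count h k ≤ t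
count-≤-bound h zero    t       below = z≤n
count-≤-bound h (suc k) t       below with h 0 in h0
... | false = count-≤-bound (h ∘ suc) k t λ i<k hi → <⇒≤ (below (s≤s i<k) hi)
count-≤-bound h (suc k) zero    below | true = contradiction (below z<s h0) λ ()
count-≤-bound h (suc k) (suc t) below | true =
  s≤s (count-≤-bound (h ∘ suc) k t λ i<k hi → ≤-pred (below (s≤s i<k) hi))

count-≤-diameter : ∀ h k s → (∀ {i j} → i < k → j < k → h i ≡ true → h j ≡ true → ∣ i - j ∣ ≤ s) →
                   count h k ≤ suc s
count-≤-diameter h zero    s close = z≤n
count-≤-diameter h (suc k) s close with h 0 in h0
... | false = count-≤-diameter (h ∘ suc) k s λ i<k j<k → close (s≤s i<k) (s≤s j<k)
... | true  = s≤s (count-≤-bound (h ∘ suc) k s λ i<k hi → close z<s (s≤s i<k) h0 hi)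

sum-point : ∀ {n} (x : Fin n) (a : ℕ) → sum (λ u → if does (u ≟ x) then a else 0) ≡ a
sum-point {suc n} zero    a = trans (cong (a +_) (sum-replicate-zero n)) (+-identityʳ a)
sum-point {suc n} (suc x) a = sum-point x a

∣tabulate∣≡sum : ∀ {n} (S : Fin n → Bool) → ∣ tabulate S ∣ ≡ sum (indicator ∘ S)
∣tabulate∣≡sum {zero}  S = refl
∣tabulate∣≡sum {suc n} S with S zero
... | true  = cong suc (∣tabulate∣≡sum (S ∘ suc))
... | false = ∣tabulate∣≡sum (S ∘ suc)

tabulate-∩ : ∀ {n} (S T : Fin n → Bool) → tabulate S ∩ tabulate T ≡ tabulate (λ u → S u ∧ T u)
tabulate-∩ {zero}  S T = refl
tabulate-∩ {suc n} S T = cong ((S zero ∧ T zero) ∷_) (tabulate-∩ (S ∘ suc) (T ∘ suc))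

image : ∀ {n} → (ℕ → Fin n) → ℕ → Fin n → Bool
image g zero    u = false
image g (suc k) u = does (u ≟ g 0) ∨ image (g ∘ suc) k u

InjectiveBelow : ∀ {n} → ℕ → (ℕ → Fin n) → Set
InjectiveBelow k g = ∀ {i j} → i < k → j < k → g i ≡ g j → i ≡ j

image-∌ : ∀ {n} (g : ℕ → Fin n) k {u} → (∀ {i} → i < k → u ≢ g i) → image g k u ≡ false
image-∌ g zero    u∉ = refl
image-∌ g (suc k) {u} u∉ with u ≟ g 0
... | yes u≡g0 = contradiction u≡g0 (u∉ z<s)
... | no  _    = image-∌ (g ∘ suc) k (u∉ ∘ s≤s)

sum-image : ∀ {n} (S : Fin n → Bool) (g : ℕ → Fin n) k → InjectiveBelow k g →
            sum (λ u → indicator (S u ∧ image g k u)) ≡ count (S ∘ g) k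
sum-image {n} S g zero    _   = trans (sum-cong-≗ (cong indicator ∘ ∧-zeroʳ ∘ S)) (sum-replicate-zero n)
sum-image {n} S g (suc k) inj = begin
  sum (λ u → indicator (S u ∧ image g (suc k) u)) ≡⟨ sum-cong-≗ split ⟩
  sum (λ u → first u + rest u)                     ≡⟨ ∑-distrib-+ first rest ⟩
  sum first + sum rest                             ≡⟨ cong₂ _+_ (sum-point (g 0) _) (sum-image S (g ∘ suc) k inj′) ⟩
  count (S ∘ g) (suc k)                            ∎
  where
  open ≡-Reasoning
  first rest : Fin n → ℕ
  first u = if does (u ≟ g 0) then indicator (S (g 0)) else 0
  rest  u = indicator (S u ∧ image (g ∘ suc) k u)
  inj′ : InjectiveBelow k (g ∘ suc)
  inj′ i<k j<k = suc-injective ∘ inj (s≤s i<k) (s≤s j<k)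
  split : ∀ u → indicator (S u ∧ image g (suc k) u) ≡ first u + rest u
  split u with u ≟ g 0
  ... | no  _    = refl
  ... | yes refl rewrite image-∌ (g ∘ suc) k λ i<k g0≡gi → 0≢1+n (inj z<s (s≤s i<k) g0≡gi)
    with S (g 0)
  ...   | true  = refl
  ...   | false = refl

anyV-intro : ∀ {n} (p : Fin n → Bool) {y} → p y ≡ true → anyV p ≡ true
anyV-intro p {zero}  py rewrite py = refl
anyV-intro p {suc y} py with p zero
... | true  = refl
... | false = anyV-intro (p ∘ suc) py

anyV-elim : ∀ {n} (p : Fin n → Bool) → anyV p ≡ true → ∃ λ y → p y ≡ true
anyV-elim {suc n} p any-p with p zero in p0
... | true  = zero , p0
... | false with y , py ← anyV-elim (p ∘ suc) any-p = suc y , py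

broadcastFrom : ∀ {n} → Fin n → ℕ → Fin n → ℕ
broadcastFrom c K u = if does (u ≟ c) then K else 0

broadcastFrom-centre : ∀ {n} (c : Fin n) K → broadcastFrom c K c ≡ K
broadcastFrom-centre c K with c ≟ c
... | yes _   = refl
... | no  c≢c = contradiction refl c≢c

module _ {n : ℕ} (G : Graph n) where

  infix 4 _─[_]─_

  data _─[_]─_ : Fin n → ℕ → Fin n → Set where
    stay : ∀ {r v} → v ─[ r ]─ v
    step : ∀ {r u w v} → adj G u w ≡ true → w ─[ r ]─ v → u ─[ suc r ]─ v

  DistanceAtLeast : ℕ → Fin n → Fin n → Set
  DistanceAtLeast D u v = ∀ {r} → u ─[ r ]─ v → D ≤ r

  IsDistance : ℕ → Fin n → Fin n → Set
  IsDistance D u v = u ─[ D ]─ v × DistanceAtLeast D u v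

  within-suc : ∀ {r u v} → u ─[ r ]─ v → u ─[ suc r ]─ v
  within-suc stay           = stay
  within-suc (step u-w w~v) = step u-w (within-suc w~v)

  within-mono : ∀ {r s u v} → r ≤ s → u ─[ r ]─ v → u ─[ s ]─ v
  within-mono r≤s       stay           = stay
  within-mono (s≤s r≤s) (step u-w w~v) = step u-w (within-mono r≤s w~v)

  within-trans : ∀ {r s u v w} → u ─[ r ]─ v → v ─[ s ]─ w → u ─[ r + s ]─ w
  within-trans {r} stay           v~w = within-mono (m≤n+m _ r) v~w
  within-trans     (step u-x x~v) v~w = step u-x (within-trans x~v v~w)

  within-snoc : ∀ {r u v w} → u ─[ r ]─ v → adj G v w ≡ true → u ─[ suc r ]─ w
  within-snoc stay           v-w = step v-w stay
  within-snoc (step u-x x~v) v-w = step u-x (within-snoc x~v v-w)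

  within-sym : ∀ {r u v} → u ─[ r ]─ v → v ─[ r ]─ u
  within-sym stay                           = stay
  within-sym {u = u} (step {w = w} u-w w~v) = within-snoc (within-sym w~v) (trans (adj-sym G w u) u-w)

  within-true⇒─ : ∀ r {u v} → within G r u v ≡ true → u ─[ r ]─ v
  within-true⇒─ zero    {u} {v} u~v with u ≟ v
  ... | yes refl = stay
  within-true⇒─ (suc r) {u} {v} u~v with within G r u v in u~v′
  ... | true  = within-suc (within-true⇒─ r u~v′)
  ... | false with w , uw~v ← anyV-elim _ u~v with adj G u w in u-w | within G r w v in w~v
  ...   | true | true = step u-w (within-true⇒─ r w~v)

  within-true-suc : ∀ {r u v} → within G r u v ≡ true → within G (suc r) u v ≡ true
  within-true-suc u~v rewrite u~v = refl

  ─⇒within-true : ∀ {r u v} → u ─[ r ]─ v → within G r u v ≡ true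
  ─⇒within-true {zero}      {v = v} stay with v ≟ v
  ... | yes _   = refl
  ... | no  v≢v = contradiction refl v≢v
  ─⇒within-true {suc r} {u}         stay = within-true-suc {r} {u} (─⇒within-true {r} stay)
  ─⇒within-true {suc r} {u} {v}     (step u-w w~v)
    rewrite anyV-intro (λ x → adj G u x ∧ within G r x v) (cong₂ _∧_ u-w (─⇒within-true w~v)) =
    ∨-zeroʳ _

  within-false⇒DistanceAtLeast : ∀ {r u v} → within G r u v ≡ false → DistanceAtLeast (suc r) u v
  within-false⇒DistanceAtLeast u≁v u~v = ≰⇒> λ s≤r →
    contradiction (trans (sym (─⇒within-true (within-mono s≤r u~v))) u≁v) λ ()

  ─⇒distance : ∀ r {u v} → u ─[ r ]─ v → ∃ λ D → IsDistance D u v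
  ─⇒distance zero            u~v = 0 , u~v , λ _ → z≤n
  ─⇒distance (suc r) {u} {v} u~v with within G r u v in u~v′
  ... | true  = ─⇒distance r (within-true⇒─ r u~v′)
  ... | false = suc r , u~v , within-false⇒DistanceAtLeast u~v′

  step-towards : ∀ {D u v} → IsDistance (suc D) u v → ∃ λ w → adj G u w ≡ true × IsDistance D w v
  step-towards (stay , atLeast)                 = contradiction (atLeast (stay {r = 0})) λ ()
  step-towards (step {w = w} u-w w~v , atLeast) =
    w , u-w , w~v , λ w~′v → ≤-pred (atLeast (step u-w w~′v))

  record Geodesic (L : ℕ) : Set where
    field
      vertex : ℕ → Fin n
      close  : ∀ {a b} → a ≤ L → b ≤ L → vertex a ─[ ∣ a - b ∣ ]─ vertex b
      apart  : ∀ {a b k} → a ≤ L → b ≤ L → vertex a ─[ k ]─ vertex b → ∣ a - b ∣ ≤ k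

  shorten : ∀ {L L′} → L′ ≤ L → Geodesic L → Geodesic L′
  shorten L′≤L γ = record
    { vertex = vertex
    ; close  = λ a≤L′ b≤L′ → close (≤-trans a≤L′ L′≤L) (≤-trans b≤L′ L′≤L)
    ; apart  = λ a≤L′ b≤L′ → apart (≤-trans a≤L′ L′≤L) (≤-trans b≤L′ L′≤L)
    }
    where open Geodesic γ

  module _ {v : Fin n} where

    private
      next : ∀ {D u} (d : IsDistance (suc D) u v) → IsDistance D (proj₁ (step-towards d)) v
      next d = proj₂ (proj₂ (step-towards d))

    walk : ∀ {D u} → IsDistance D u v → ℕ → Fin n
    walk {u = u}     d zero    = u
    walk {zero}  {u} d (suc i) = u
    walk {suc D}     d (suc i) = walk (next d) i

    walk-distance : ∀ {D u} (d : IsDistance D u v) {i} → i ≤ D → IsDistance (D ∸ i) (walk d i) v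
    walk-distance         d {zero}  _         = d
    walk-distance {suc D} d {suc i} (s≤s i≤D) = walk-distance (next d) i≤D

    walk-adj : ∀ {D u} (d : IsDistance D u v) {i} → i < D → adj G (walk d i) (walk d (suc i)) ≡ true
    walk-adj {suc D} d {zero}  _         = proj₁ (proj₂ (step-towards d))
    walk-adj {suc D} d {suc i} (s≤s i<D) = walk-adj (next d) i<D

    walk-within : ∀ {D u} (d : IsDistance D u v) i k → i + k ≤ D → walk d i ─[ k ]─ walk d (i + k)
    walk-within d i zero    _     rewrite +-identityʳ i = stay
    walk-within d i (suc k) i+k<D rewrite +-suc i k     =
      within-snoc (walk-within d i k (<⇒≤ i+k<D)) (walk-adj d i+k<D)

    walk-close : ∀ {D u} (d : IsDistance D u v) {a b} → a ≤ b → b ≤ D → walk d a ─[ b ∸ a ]─ walk d b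
    walk-close d {a} {b} a≤b b≤D =
      subst (λ x → walk d a ─[ b ∸ a ]─ walk d x) (m+[n∸m]≡n a≤b)
        (walk-within d a (b ∸ a) (subst (_≤ _) (sym (m+[n∸m]≡n a≤b)) b≤D))

    -- The vertex at position i lies at distance exactly D ∸ i from v.
    walk-apart : ∀ {D u} (d : IsDistance D u v) {a b k} → a ≤ D → b ≤ D →
                 walk d a ─[ k ]─ walk d b → b ≤ a + k
    walk-apart {D} d {a} {b} {k} a≤D b≤D a~b = +-cancelʳ-≤ (D ∸ b) b (a + k) (begin
      b + (D ∸ b)       ≡⟨ m+[n∸m]≡n b≤D ⟩
      D                 ≡⟨ m+[n∸m]≡n a≤D ⟨
      a + (D ∸ a)       ≤⟨ +-monoʳ-≤ a (proj₂ (walk-distance d a≤D) a~v) ⟩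
      a + (k + (D ∸ b)) ≡⟨ +-assoc a k (D ∸ b) ⟨
      a + k + (D ∸ b)   ∎)
      where
      open ≤-Reasoning
      a~v : walk d a ─[ k + (D ∸ b) ]─ v
      a~v = within-trans a~b (proj₁ (walk-distance d b≤D))

  geodesic : ∀ {D u v} → IsDistance D u v → Geodesic D
  geodesic {D} d = record { vertex = walk d ; close = close ; apart = apart }
    where
    close : ∀ {a b} → a ≤ D → b ≤ D → walk d a ─[ ∣ a - b ∣ ]─ walk d b
    close {a} {b} a≤D b≤D with ≤-total a b
    ... | inj₁ a≤b rewrite m≤n⇒∣m-n∣≡n∸m a≤b = walk-close d a≤b b≤D
    ... | inj₂ b≤a rewrite m≤n⇒∣n-m∣≡n∸m b≤a = within-sym (walk-close d b≤a a≤D)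
    apart : ∀ {a b k} → a ≤ D → b ≤ D → walk d a ─[ k ]─ walk d b → ∣ a - b ∣ ≤ k
    apart a≤D b≤D a~b = ∣m-n∣≤o (walk-apart d a≤D b≤D a~b) (walk-apart d b≤D a≤D (within-sym a~b))

  module Packing {M : ℕ} (3≤M : 3 ≤ M) (γ : Geodesic (3 * M))
                 (w : Fin n) (w-far : DistanceAtLeast (3 * M) w (Geodesic.vertex γ 4)) where

    open Geodesic γ

    point : ℕ → Fin n
    point zero    = w
    point (suc i) = vertex (3 * i)

    9≤3M : 9 ≤ 3 * M
    9≤3M = *-monoʳ-≤ 3 3≤M

    3i≤3M : ∀ {i} → i ≤ M → 3 * i ≤ 3 * M
    3i≤3M = *-monoʳ-≤ 3

    meet : ∀ {r x y v} → x ─[ r ]─ v → y ─[ r ]─ v → x ─[ r + r ]─ y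
    meet x~v y~v = within-trans x~v (within-sym y~v)

    spread : ∀ {i j k} → i ≤ M → j ≤ M → vertex (3 * i) ─[ k ]─ vertex (3 * j) → 3 * ∣ i - j ∣ ≤ k
    spread {i} {j} i≤M j≤M x~y =
      subst (_≤ _) (sym (*-distribˡ-∣-∣ 3 i j)) (apart (3i≤3M i≤M) (3i≤3M j≤M) x~y)

    w-via-vertex4 : ∀ {i k} → i ≤ M → w ─[ k ]─ vertex (3 * i) → 3 * M ≤ k + ∣ 3 * i - 4 ∣
    w-via-vertex4 i≤M w~x = w-far (within-trans w~x (close (3i≤3M i≤M) (≤-trans (m≤m+n 4 5) 9≤3M)))

    w-apart : ∀ {i k} → i ≤ M → w ─[ k ]─ vertex (3 * i) → 4 ≤ k
    w-apart {i} {k} i≤M w~x =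
      +-cancelʳ-≤ _ 4 k (≤-trans (4+∣3i-4∣≤3M 3≤M i≤M) (w-via-vertex4 i≤M w~x))

    w-apart-inner : ∀ {i k} → 0 < i → i < M → w ─[ k ]─ vertex (3 * i) → 7 ≤ k
    w-apart-inner {i} {k} 0<i i<M w~x =
      +-cancelʳ-≤ _ 7 k (≤-trans (7+∣3i-4∣≤3M 3≤M 0<i i<M) (w-via-vertex4 (<⇒≤ i<M) w~x))

    point-injective : InjectiveBelow (2 + M) point
    point-injective {zero}  {zero}  _        _        _   = refl
    point-injective {zero}  {suc j} _        (s≤s j<) w≡x =
      contradiction (w-apart (≤-pred j<) (subst (w ─[ 0 ]─_) w≡x stay)) λ ()
    point-injective {suc i} {zero}  (s≤s i<) _        x≡w =
      contradiction (w-apart (≤-pred i<) (subst (w ─[ 0 ]─_) (sym x≡w) stay)) λ ()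
    point-injective {suc i} {suc j} (s≤s i<) (s≤s j<) x≡y =
      cong suc (*-cancelˡ-≡ i j 3 (∣m-n∣≡0⇒m≡n (n≤0⇒n≡0
        (apart (3i≤3M (≤-pred i<)) (3i≤3M (≤-pred j<)) (subst (vertex (3 * i) ─[ 0 ]─_) x≡y stay)))))

    near-w⇒end : ∀ {i k} → i ≤ M → k ≤ 6 → w ─[ k ]─ vertex (3 * i) → i ≡ 0 ⊎ i ≡ M
    near-w⇒end {zero}  _   _   _   = inj₁ refl
    near-w⇒end {suc i} i≤M k≤6 w~x with m≤n⇒m<n∨m≡n i≤M
    ... | inj₁ i<M = contradiction (≤-trans (w-apart-inner z<s i<M w~x) k≤6) 1+n≰n
    ... | inj₂ i≡M = inj₂ i≡M

    ends-not-within-6 : ∀ {k} → k ≤ 6 → ¬ vertex 0 ─[ k ]─ vertex (3 * M)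
    ends-not-within-6 k≤6 ends =
      contradiction (≤-trans 9≤3M (≤-trans (apart z≤n ≤-refl ends) k≤6)) (m+1+n≰m 6)

    near-w-unique : ∀ {r v i j} → r + r ≤ 6 → w ─[ r ]─ v → i ≤ M → j ≤ M →
                    vertex (3 * i) ─[ r ]─ v → vertex (3 * j) ─[ r ]─ v → i ≡ j
    near-w-unique 2r≤6 w~v i≤M j≤M i~v j~v
      with near-w⇒end i≤M 2r≤6 (meet w~v i~v) | near-w⇒end j≤M 2r≤6 (meet w~v j~v)
    ... | inj₁ refl | inj₁ refl = refl
    ... | inj₂ refl | inj₂ refl = refl
    ... | inj₁ refl | inj₂ refl = contradiction (meet i~v j~v) (ends-not-within-6 2r≤6)
    ... | inj₂ refl | inj₁ refl = contradiction (meet j~v i~v) (ends-not-within-6 2r≤6)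

    pair-gap : ∀ {s v i j} → i ≤ M → j ≤ M →
               vertex (3 * i) ─[ suc s ]─ v → vertex (3 * j) ─[ suc s ]─ v → ∣ i - j ∣ ≤ s
    pair-gap {s} i≤M j≤M i~v j~v = 3d≤k<3[1+s]⇒d≤s (spread i≤M j≤M (meet i~v j~v)) (2[1+s]<3[1+s] s)

    pair-gap-near-w : ∀ {s v i j} → w ─[ 2 + s ]─ v → i ≤ M → j ≤ M →
                      vertex (3 * i) ─[ 2 + s ]─ v → vertex (3 * j) ─[ 2 + s ]─ v → ∣ i - j ∣ ≤ s
    pair-gap-near-w {zero}        w~v i≤M j≤M i~v j~v =
      ≤-reflexive (m≡n⇒∣m-n∣≡0 (near-w-unique (m≤m+n 4 2) w~v i≤M j≤M i~v j~v))
    pair-gap-near-w {suc zero}    w~v i≤M j≤M i~v j~v =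
      ≤-trans (≤-reflexive (m≡n⇒∣m-n∣≡0 (near-w-unique ≤-refl w~v i≤M j≤M i~v j~v))) z≤n
    pair-gap-near-w {suc (suc t)} _   i≤M j≤M i~v j~v =
      3d≤k<3[1+s]⇒d≤s (spread i≤M j≤M (meet i~v j~v)) (2[4+t]<3[3+t] t)

    vertices-in-ball : ∀ s v → count (λ i → within G (suc s) (vertex (3 * i)) v) (suc M) ≤ suc s
    vertices-in-ball s v = count-≤-diameter _ (suc M) s λ i< j< i∈ j∈ →
      pair-gap (≤-pred i<) (≤-pred j<) (within-true⇒─ (suc s) i∈) (within-true⇒─ (suc s) j∈)

    vertices-in-ball-near-w : ∀ s v → w ─[ suc s ]─ v →
                              count (λ i → within G (suc s) (vertex (3 * i)) v) (suc M) ≤ s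
    vertices-in-ball-near-w zero    v w~v = count-≤-bound _ (suc M) 0 λ i< i∈ →
      contradiction (w-apart (≤-pred i<) (meet w~v (within-true⇒─ 1 i∈))) λ { (s≤s (s≤s ())) }
    vertices-in-ball-near-w (suc s) v w~v = count-≤-diameter _ (suc M) s λ i< j< i∈ j∈ →
      pair-gap-near-w w~v (≤-pred i<) (≤-pred j<) (within-true⇒─ (2 + s) i∈) (within-true⇒─ (2 + s) j∈)

    P : Subset n
    P = tabulate (image point (2 + M))

    ∣P∣≡2+M : ∣ P ∣ ≡ 2 + M
    ∣P∣≡2+M = begin
      ∣ P ∣                                         ≡⟨ ∣tabulate∣≡sum (image point (2 + M)) ⟩
      sum (λ u → indicator (image point (2 + M) u)) ≡⟨ sum-image (λ _ → true) point (2 + M) point-injective ⟩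
      count (λ _ → true) (2 + M)                    ≡⟨ count-const-true (2 + M) ⟩
      2 + M                                         ∎
      where open ≡-Reasoning

    ∣ball∩P∣ : ∀ r v → ∣ ball G r v ∩ P ∣ ≡ count (λ i → within G r (point i) v) (2 + M)
    ∣ball∩P∣ r v = begin
      ∣ ball G r v ∩ P ∣
        ≡⟨ cong ∣_∣ (tabulate-∩ (λ u → within G r u v) (image point (2 + M))) ⟩
      ∣ tabulate inBoth ∣
        ≡⟨ ∣tabulate∣≡sum inBoth ⟩
      sum (indicator ∘ inBoth)
        ≡⟨ sum-image (λ u → within G r u v) point (2 + M) point-injective ⟩
      count (λ i → within G r (point i) v) (2 + M) ∎
      where
      open ≡-Reasoning
      inBoth : Fin n → Bool
      inBoth u = within G r u v ∧ image point (2 + M) u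

    P-multipacking : IsMultipacking G P
    P-multipacking v (suc s) _ rewrite ∣ball∩P∣ (suc s) v with within G (suc s) w v in w∈
    ... | false = vertices-in-ball s v
    ... | true  = s≤s (vertices-in-ball-near-w s v (within-true⇒─ (suc s) w∈))

  large-multipacking : ∀ {M} → Connected G → 3 ≤ M → Fin n →
                       (∀ c → ∃ λ u → DistanceAtLeast (3 * M) u c) →
                       Σ (Subset n) λ P → IsMultipacking G P × ∣ P ∣ ≡ 2 + M
  large-multipacking connected 3≤M c₀ eccentric
    with u , u-far ← eccentric c₀
    with r , u~c₀  ← connected u c₀
    with D , u─c₀  ← ─⇒distance r (within-true⇒─ r u~c₀)
    = let γ         = shorten (u-far (proj₁ u─c₀)) (geodesic u─c₀)
          (w , w-far) = eccentric (Geodesic.vertex γ 4)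
          open Packing 3≤M γ w w-far
      in P , P-multipacking , ∣P∣≡2+M

  broadcastFrom-dominating : ∀ {c K} → 0 < K → (∀ u → within G K u c ≡ true) →
                             IsDominatingBroadcast G (broadcastFrom c K)
  broadcastFrom-dominating {c} {K} 0<K covers u = c , reaches-u
    where
    reaches-u : 0 < broadcastFrom c K c × within G (broadcastFrom c K c) u c ≡ true
    reaches-u rewrite broadcastFrom-centre c K = 0<K , covers u

  no-centre⇒eccentric : ∀ K → ¬ (∃ λ c → ∀ u → within G K u c ≡ true) →
                        ∀ c → ∃ λ u → DistanceAtLeast (suc K) u c
  no-centre⇒eccentric K no-centre c
    with u , u-out ← ¬∀⟶∃¬ n _ (λ u → within G K u c ≟ᵇ true) (λ covers → no-centre (c , covers))
    = u , within-false⇒DistanceAtLeast (¬-not u-out)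

  broadcast-or-packing : ∀ {M} → Connected G → 3 ≤ M → Fin n → ∀ K → suc K ≡ 3 * M →
                         (Σ (Fin n → ℕ) λ f → IsDominatingBroadcast G f × cost f ≡ K) ⊎
                         (Σ (Subset n) λ P → IsMultipacking G P × ∣ P ∣ ≡ 2 + M)
  broadcast-or-packing {M} connected 3≤M c₀ K 1+K≡3M with any? (λ c → all? (λ u → within G K u c ≟ᵇ true))
  ... | yes (c , covers) = inj₁ (broadcastFrom c K , broadcastFrom-dominating 0<K covers , sum-point c K)
    where
    0<K : 0 < K
    0<K = ≤-pred (subst (2 ≤_) (sym 1+K≡3M) (≤-trans (m≤m+n 2 7) (*-monoʳ-≤ 3 3≤M)))
  ... | no  no-centre    = inj₂ (large-multipacking connected 3≤M c₀ eccentric)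
    where
    eccentric : ∀ c → ∃ λ u → DistanceAtLeast (3 * M) u c
    eccentric rewrite sym 1+K≡3M = no-centre⇒eccentric K no-centre

proposition9 : ∀ (n : ℕ) (G : Graph n) → Connected G → ∀ (m : ℕ) → IsMultipackingNumber G m → 4 ≤ m → Σ (Fin n → ℕ) λ f → IsDominatingBroadcast G f × cost f ≤ 3 * m ∸ 4
proposition9 zero    G _         _       _             _         = (λ ()) , (λ ()) , z≤n
proposition9 (suc n) G connected (suc M) (_ , maximal) (s≤s 3≤M)
  with broadcast-or-packing G connected 3≤M zero (3 * suc M ∸ 4) (1+[3[1+M]∸4]≡3M M (≤-trans (s≤s z≤n) 3≤M))
... | inj₁ (f , dominating , cost≡K)    = f , dominating , ≤-reflexive cost≡K
... | inj₂ (P , multipacking , ∣P∣≡2+M) =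
  contradiction (maximal P multipacking) (subst (_≰ suc M) (sym ∣P∣≡2+M) 1+n≰n)
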